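{- For every finite simple triangle-free graph $G$, $\operatorname{elb}(G) \leq \operatorname{cc}(L(G))$.
   Context: All graphs are finite, simple, without loops. The line graph $L(G)$ of $G$ has vertex set $E(G)$, two vertices being adjacent iff the corresponding edges of $G$ share an endpoint. A chordal graph is a graph with no induced cycle of length more than three. The chordal covering number $\operatorname{cc}(H)$ of a graph $H$ is the minimum number of chordal graphs (on subsets of $V(H)$) whose union is $H$. An orientation of $G$ assigns a direction to each edge. Two adjacent edges $xy, xz$ of $G$ form an elbow in an orientation if both are directed towards $x$ or both are directed away from $x$. An elbow cover of $G$ is a family $\mathcal{O}$ of orientations of $G$ such that every pair of adjacent edges $xy, xz$ of $G$ forms an elbow in at least one orientation in $\mathcal{O}$; $\operatorname{elb}(G)$ is the minimum size of an elbow cover of $G$. -}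

module Defs where

open import Level using (Level; _⊔_) renaming (suc to lsuc; zero to lzero)
open import Data.Nat using (ℕ; zero; suc; _≤_)
open import Data.Fin using (Fin; toℕ) renaming (_<_ to _<ᶠ_)
open import Data.Bool using (Bool; true; false)
open import Data.Product using (Σ; ∃; ∃-syntax; _×_; _,_; proj₁; proj₂)
open import Data.Sum using (_⊎_)
open import Relation.Binary.PropositionalEquality using (_≡_)
open import Relation.Nullary using (¬_)
open import Function.Definitions using (Injective)

record Graph (n : ℕ) : Set where
  field
    adj    : Fin n → Fin n → Bool
    sym    : ∀ x y → adj x y ≡ true → adj y x ≡ true
    irrefl : ∀ x → ¬ (adj x x ≡ true)

open Graph public

Adj : ∀ {n} → Graph n → Fin n → Fin n → Set
Adj G x y = adj G x y ≡ true

TriangleFree : ∀ {n} → Graph n → Set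
TriangleFree G = ∀ x y z → ¬ (Adj G x y × Adj G y z × Adj G x z)

-- Line graph.  An edge of G is stored once, as (i , j) with i < j.

Edge : ∀ {n} → Graph n → Set
Edge {n} G = Σ (Fin n) λ i → Σ (Fin n) λ j → (i <ᶠ j) × Adj G i j

end₁ end₂ : ∀ {n} (G : Graph n) → Edge G → Fin n
end₁ G (i , _ , _) = i
end₂ G (_ , j , _) = j

LineAdj : ∀ {n} (G : Graph n) → Edge G → Edge G → Set
LineAdj G e f =
  ¬ (end₁ G e ≡ end₁ G f × end₂ G e ≡ end₂ G f) ×
  (end₁ G e ≡ end₁ G f ⊎ end₁ G e ≡ end₂ G f ⊎ end₂ G e ≡ end₁ G f ⊎ end₂ G e ≡ end₂ G f)

Succ : (k : ℕ) → Fin k → Fin k → Set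
Succ k i j = suc (toℕ i) ≡ toℕ j ⊎ (suc (toℕ i) ≡ k × toℕ j ≡ 0)

CycAdj : (k : ℕ) → Fin k → Fin k → Set
CycAdj k i j = Succ k i j ⊎ Succ k j i

IsInducedCycle : ∀ {a r} {V : Set a} (R : V → V → Set r) (k : ℕ) → (Fin k → V) → Set (a ⊔ r)
IsInducedCycle R k c =
  Injective _≡_ _≡_ c ×
  (∀ i j → (R (c i) (c j) → CycAdj k i j) × (CycAdj k i j → R (c i) (c j)))

Chordal : ∀ {a r} {V : Set a} (R : V → V → Set r) → Set (a ⊔ r)
Chordal {V = V} R = ∀ k → 4 ≤ k → (c : Fin k → V) → ¬ IsInducedCycle R k c

record ChordalSubgraph {a r} {V : Set a} (R : V → V → Set r) : Set (lsuc (a ⊔ r)) where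
  field
    verts   : V → Set a
    edges   : V → V → Set r
    sub     : ∀ x y → edges x y → R x y
    inVerts : ∀ x y → edges x y → verts x × verts y
    esym    : ∀ x y → edges x y → edges y x
    chordal : Chordal edges

record ChordalCover {a r} {V : Set a} (R : V → V → Set r) (k : ℕ) : Set (lsuc (a ⊔ r)) where
  field
    part      : Fin k → ChordalSubgraph R
    coverV    : ∀ x → ∃[ t ] ChordalSubgraph.verts (part t) x
    coverE    : ∀ x y → R x y → ∃[ t ] ChordalSubgraph.edges (part t) x y

record Orientation {n} (G : Graph n) : Set₁ where
  field
    arc      : Fin n → Fin n → Set
    total    : ∀ x y → Adj G x y → arc x y ⊎ arc y x
    arcEdge  : ∀ x y → arc x y → Adj G x y
    antisym  : ∀ x y → arc x y → ¬ arc y x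

Elbow : ∀ {n} {G : Graph n} → Orientation G → Fin n → Fin n → Fin n → Set
Elbow O x y z = (arc y x × arc z x) ⊎ (arc x y × arc x z)
  where open Orientation O

ElbowCover : ∀ {n} (G : Graph n) (k : ℕ) → Set₁
ElbowCover {n} G k =
  Σ (Fin k → Orientation G) λ O →
    ∀ x y z → Adj G x y → Adj G x z → ¬ (y ≡ z) → ∃[ t ] Elbow (O t) x y z

module Submission where

-- Encode an orientation of G by a Boolean label ℓ on the edges.  Two edges e, f
-- meeting at x form an elbow at x iff ℓ e xor ℓ f equals a fixed sign σ(e, f),
-- namely whether x is the smaller end of exactly one of e, f.  So for each part
-- H of the cover we need a labelling with ℓ e xor ℓ f ≡ σ e f along the edges
-- of H, i.e. a "potential" for the signed graph (H, σ).
--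
--  * Balance: in a chordal graph whose triangles are even, every closed walk is
--    even (a shortest odd closed walk of length ≥ 4 would be an induced cycle).
--    Triangles of L(G) are stars since G is triangle-free, hence even.
--  * Potential: on a finitely listed vertex set, if every closed walk is even,
--    labelling each vertex by the parity of walks from the first vertex of its
--    component is consistent.  Reachability is not decidable for an arbitrary
--    relation, so this is obtained under double negation.
--  * The labels are coded by a finite bit vector, and the existence of a good
--    code for a part is decidable, which removes the double negation.
--  * Each good code gives an orientation; together they form the elbow cover.

open import Defs hiding (sym)
open import Data.Nat using (ℕ; zero; suc; _+_; _*_; _∸_; _≤_; _<_; _≤?_; z≤n; s≤s)
open import Data.Nat.Properties as ℕ using ()
open import Data.Bool using (Bool; true; false; _xor_; not) renaming (_≟_ to _≟ᵇ_)
open import Data.Bool.Properties using (xor-assoc; xor-comm; xor-same; xor-identityʳ; not-involutive)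
open import Data.Fin as F using (Fin; toℕ; _≟_)
open import Data.Fin.Properties using (toℕ<n; <-cmp; _<?_; <-irrelevant; all?; remQuot-combine)
open import Data.Fin.Subset using (Subset)
open import Data.Fin.Subset.Properties using (anySubset?)
open import Data.Vec as Vec using ()
open import Data.Vec.Properties using (lookup∘tabulate)
open import Data.Product using (Σ; ∃-syntax; _×_; _,_; proj₁; proj₂; uncurry)
open import Data.Sum using (_⊎_; inj₁; inj₂; swap)
open import Data.Empty using (⊥-elim)
open import Data.List using (List; []; _∷_; filter; mapMaybe; cartesianProduct; allFin)
open import Data.Maybe using (Maybe; just; nothing; maybe)
open import Data.Maybe.Properties using (≡-dec)
open import Data.List.Properties using (filter-≐)
open import Data.List.Membership.Propositional using (_∈_)
open import Data.List.Membership.Propositional.Properties using (∈-filter⁺; ∈-filter⁻; ∈-cartesianProduct⁺; ∈-allFin)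
open import Data.List.Relation.Unary.Any using (here; there)
open import Relation.Nullary using (¬_; Dec; yes; no; does)
open import Relation.Nullary.Decidable using (¬¬-excluded-middle; dec-true; dec-false; _→-dec_)
open import Relation.Binary using (tri<; tri≈; tri>)
open import Axiom.UniquenessOfIdentityProofs using (module Decidable⇒UIP)
open import Relation.Binary.PropositionalEquality
  using (_≡_; refl; sym; trans; cong; cong₂; subst; subst₂; module ≡-Reasoning)

xor≡false⇒≡ : ∀ a b → a xor b ≡ false → a ≡ b
xor≡false⇒≡ false false _ = refl
xor≡false⇒≡ true  true  _ = refl

true≢false : ¬ true ≡ false
true≢false ()

xor-cancelˡ : ∀ a b → a xor (a xor b) ≡ b
xor-cancelˡ a b = trans (sym (xor-assoc a a b)) (cong (_xor b) (xor-same a))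

xor-cancelʳ : ∀ a b → (a xor b) xor b ≡ a
xor-cancelʳ a b = trans (xor-assoc a b b) (trans (cong (a xor_) (xor-same b)) (xor-identityʳ a))

xor-transpose : ∀ a b c d → a xor b ≡ c xor d → c xor a ≡ d xor b
xor-transpose a b c d a+b≡c+d = begin
  c xor a                    ≡⟨ cong (c xor_) (sym (xor-cancelʳ a b)) ⟩
  c xor ((a xor b) xor b)    ≡⟨ cong (λ s → c xor (s xor b)) a+b≡c+d ⟩
  c xor ((c xor d) xor b)    ≡⟨ cong (c xor_) (xor-assoc c d b) ⟩
  c xor (c xor (d xor b))    ≡⟨ xor-cancelˡ c (d xor b) ⟩
  d xor b                    ∎
  where open ≡-Reasoning

-- the signs around a triangle through one common vertex cancel
xor-cycle : ∀ a b c → (a xor b) xor ((b xor c) xor (c xor a)) ≡ false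
xor-cycle a b c = begin
  (a xor b) xor ((b xor c) xor (c xor a))   ≡⟨ cong ((a xor b) xor_) (xor-assoc b c (c xor a)) ⟩
  (a xor b) xor (b xor (c xor (c xor a)))   ≡⟨ cong (λ s → (a xor b) xor (b xor s)) (xor-cancelˡ c a) ⟩
  (a xor b) xor (b xor a)                   ≡⟨ cong ((a xor b) xor_) (xor-comm b a) ⟩
  (a xor b) xor (a xor b)                   ≡⟨ xor-same (a xor b) ⟩
  false                                     ∎
  where open ≡-Reasoning

module Walks {V : Set} (H : V → V → Set) (σ : V → V → Bool) where

  infixr 5 _∷_ _++_
  data Walk : V → V → Set where
    []  : ∀ {a} → Walk a a
    _∷_ : ∀ {a b c} → H a b → Walk b c → Walk a c

  length : ∀ {a b} → Walk a b → ℕ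
  length []      = 0
  length (_ ∷ w) = suc (length w)

  parity : ∀ {a b} → Walk a b → Bool
  parity []                = false
  parity (_∷_ {a} {b} _ w) = σ a b xor parity w

  _++_ : ∀ {a b c} → Walk a b → Walk b c → Walk a c
  []      ++ q = q
  (h ∷ p) ++ q = h ∷ (p ++ q)

  length-++ : ∀ {a b c} (p : Walk a b) (q : Walk b c) → length (p ++ q) ≡ length p + length q
  length-++ []      q = refl
  length-++ (h ∷ p) q = cong suc (length-++ p q)

  parity-++ : ∀ {a b c} (p : Walk a b) (q : Walk b c) → parity (p ++ q) ≡ parity p xor parity q
  parity-++ []                q = refl
  parity-++ (_∷_ {a} {b} h p) q =
    trans (cong (σ a b xor_) (parity-++ p q)) (sym (xor-assoc (σ a b) (parity p) (parity q)))

  -- the i-th vertex of a walk (the last one beyond its length)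
  vertex : ∀ {a b} → Walk a b → ℕ → V
  vertex {a} w       zero    = a
  vertex {a} []      (suc i) = a
  vertex     (_ ∷ w) (suc i) = vertex w i

  take : ∀ {a b} (w : Walk a b) (i : ℕ) → Walk a (vertex w i)
  take w       zero    = []
  take []      (suc i) = []
  take (h ∷ w) (suc i) = h ∷ take w i

  drop : ∀ {a b} (w : Walk a b) (i : ℕ) → Walk (vertex w i) b
  drop w       zero    = w
  drop []      (suc i) = []
  drop (h ∷ w) (suc i) = drop w i

  take-++-drop : ∀ {a b} (w : Walk a b) i → take w i ++ drop w i ≡ w
  take-++-drop w       zero    = refl
  take-++-drop []      (suc i) = refl
  take-++-drop (h ∷ w) (suc i) = cong (h ∷_) (take-++-drop w i)

  length-take : ∀ {a b} (w : Walk a b) i → i ≤ length w → length (take w i) ≡ i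
  length-take w       zero    _         = refl
  length-take (h ∷ w) (suc i) (s≤s i≤n) = cong suc (length-take w i i≤n)

  length-split : ∀ {a b} (w : Walk a b) i → length (take w i) + length (drop w i) ≡ length w
  length-split w i = trans (sym (length-++ (take w i) (drop w i))) (cong length (take-++-drop w i))

  length-drop : ∀ {a b} (w : Walk a b) i → i ≤ length w → i + length (drop w i) ≡ length w
  length-drop w i i≤n = trans (cong (_+ length (drop w i)) (sym (length-take w i i≤n))) (length-split w i)

  parity-split : ∀ {a b} (w : Walk a b) i → parity (take w i) xor parity (drop w i) ≡ parity w
  parity-split w i = trans (sym (parity-++ (take w i) (drop w i))) (cong parity (take-++-drop w i))

  vertex-drop : ∀ {a b} (w : Walk a b) i d → vertex (drop w i) d ≡ vertex w (i + d)
  vertex-drop w       zero    d = refl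
  vertex-drop []      (suc i) zero = refl
  vertex-drop []      (suc i) (suc d) = refl
  vertex-drop (h ∷ w) (suc i) d = vertex-drop w i d

  vertex-++ˡ : ∀ {a b c} (p : Walk a b) (q : Walk b c) d → d ≤ length p → vertex (p ++ q) d ≡ vertex p d
  vertex-++ˡ p       q zero    _         = refl
  vertex-++ˡ (h ∷ p) q (suc d) (s≤s d≤n) = vertex-++ˡ p q d d≤n

  vertex-end : ∀ {a b} (w : Walk a b) → vertex w (length w) ≡ b
  vertex-end []      = refl
  vertex-end (h ∷ w) = vertex-end w

  step : ∀ {a b} (w : Walk a b) i → suc i ≤ length w → H (vertex w i) (vertex w (suc i))
  step (h ∷ w) zero    _         = h
  step (h ∷ w) (suc i) (s≤s i<n) = step w i i<n

  rotate : ∀ {a} (w : Walk a a) i → Walk (vertex w i) (vertex w i)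
  rotate w i = drop w i ++ take w i

  length-rotate : ∀ {a} (w : Walk a a) i → length (rotate w i) ≡ length w
  length-rotate w i = begin
    length (drop w i ++ take w i)            ≡⟨ length-++ (drop w i) (take w i) ⟩
    length (drop w i) + length (take w i)    ≡⟨ ℕ.+-comm (length (drop w i)) _ ⟩
    length (take w i) + length (drop w i)    ≡⟨ length-split w i ⟩
    length w                                 ∎
    where open ≡-Reasoning

  parity-rotate : ∀ {a} (w : Walk a a) i → parity (rotate w i) ≡ parity w
  parity-rotate w i = begin
    parity (drop w i ++ take w i)            ≡⟨ parity-++ (drop w i) (take w i) ⟩
    parity (drop w i) xor parity (take w i)  ≡⟨ xor-comm (parity (drop w i)) _ ⟩
    parity (take w i) xor parity (drop w i)  ≡⟨ parity-split w i ⟩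
    parity w                                 ∎
    where open ≡-Reasoning

  vertex-rotate : ∀ {a} (w : Walk a a) i d → i + d ≤ length w → vertex (rotate w i) d ≡ vertex w (i + d)
  vertex-rotate w i d i+d≤n = trans (vertex-++ˡ (drop w i) (take w i) d d≤) (vertex-drop w i d)
    where
    d≤ : d ≤ length (drop w i)
    d≤ = ℕ.+-cancelˡ-≤ i d (length (drop w i))
           (subst (i + d ≤_) (sym (length-drop w i (ℕ.m+n≤o⇒m≤o i i+d≤n))) i+d≤n)

-- A chordal graph whose triangles are even (under σ) has only even closed
-- walks: among odd closed walks, a shortest one of length ≥ 4 would be an
-- induced cycle, while shorter ones are excluded directly.
module Balance {V : Set} (H : V → V → Set) (σ : V → V → Bool)
  (H-sym      : ∀ {a b} → H a b → H b a)
  (H-irrefl   : ∀ {a} → ¬ H a a)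
  (σ-sym      : ∀ {a b} → H a b → σ a b ≡ σ b a)
  (σ-triangle : ∀ {a b c} → H a b → H b c → H c a → σ a b xor (σ b c xor σ c a) ≡ false)
  (chordal    : Chordal H) where

  open Walks H σ

  EvenBelow : ℕ → Set
  EvenBelow L = ∀ {a b} (w : Walk a b) → a ≡ b → length w < L → parity w ≡ false

  MinimalOdd : ∀ {a} → Walk a a → Set
  MinimalOdd w = parity w ≡ true × EvenBelow (length w)

  no-return : ∀ {a} (w : Walk a a) → MinimalOdd w → ∀ d → 0 < d → d < length w → ¬ vertex w d ≡ a
  no-return w (odd , shorter) d 0<d d<n returns = true≢false (begin
    true                                        ≡⟨ sym odd ⟩
    parity w                                    ≡⟨ sym (parity-split w d) ⟩
    parity (take w d) xor parity (drop w d)     ≡⟨ cong₂ _xor_ even-take even-drop ⟩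
    false                                       ∎)
    where
    open ≡-Reasoning
    even-take : parity (take w d) ≡ false
    even-take = shorter (take w d) (sym returns)
      (subst (_< length w) (sym (length-take w d (ℕ.<⇒≤ d<n))) d<n)
    even-drop : parity (drop w d) ≡ false
    even-drop = shorter (drop w d) returns
      (subst (length (drop w d) <_) (length-drop w d (ℕ.<⇒≤ d<n)) (ℕ.m<n+m _ 0<d))

  -- in a minimal odd closed walk the start vertex has no chord to the vertex
  -- at position d when 2 ≤ d ≤ length − 2: following the chord would split
  -- the walk into two shorter closed walks, one of them odd
  no-chord : ∀ {a} (w : Walk a a) → MinimalOdd w → ∀ d → 2 ≤ d → d + 2 ≤ length w → ¬ H a (vertex w d)
  no-chord {a} w (odd , shorter) d 2≤d d+2≤n h = true≢false (begin
    true                                        ≡⟨ sym odd ⟩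
    parity w                                    ≡⟨ sym (parity-split w d) ⟩
    parity (take w d) xor parity (drop w d)     ≡⟨ cong₂ _xor_ take-sign drop-sign ⟩
    σ x a xor σ a x                             ≡⟨ cong (σ x a xor_) (σ-sym h) ⟩
    σ x a xor σ x a                             ≡⟨ xor-same (σ x a) ⟩
    false                                       ∎)
    where
    open ≡-Reasoning
    x : V
    x = vertex w d
    d≤n : d ≤ length w
    d≤n = ℕ.m+n≤o⇒m≤o d d+2≤n
    first-loop : Walk a a
    first-loop = take w d ++ (H-sym h ∷ [])
    second-loop : Walk a a
    second-loop = h ∷ drop w d
    first-short : length first-loop < length w
    first-short = subst (_< length w)
      (sym (trans (length-++ (take w d) _) (cong (_+ 1) (length-take w d d≤n))))
      (ℕ.<-≤-trans (ℕ.+-monoʳ-< d (ℕ.n<1+n 1)) d+2≤n)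
    second-short : length second-loop < length w
    second-short = subst (suc (length (drop w d)) <_) (length-drop w d d≤n)
      (ℕ.+-monoˡ-≤ (length (drop w d)) 2≤d)
    take-sign : parity (take w d) ≡ σ x a
    take-sign = trans
      (xor≡false⇒≡ (parity (take w d)) (σ x a xor false)
        (trans (sym (parity-++ (take w d) _)) (shorter first-loop refl first-short)))
      (xor-identityʳ (σ x a))
    drop-sign : parity (drop w d) ≡ σ a x
    drop-sign = sym (xor≡false⇒≡ (σ a x) (parity (drop w d)) (shorter second-loop refl second-short))

  rotate-minimal : ∀ {a} (w : Walk a a) → MinimalOdd w → ∀ i → MinimalOdd (rotate w i)
  rotate-minimal w (odd , shorter) i =
    trans (parity-rotate w i) odd ,
    λ u e lt → shorter u e (subst (length u <_) (length-rotate w i) lt)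

  distinct : ∀ {a} (w : Walk a a) → MinimalOdd w →
             ∀ i d → 0 < d → i + d < length w → ¬ vertex w i ≡ vertex w (i + d)
  distinct w m i d 0<d i+d<n repeated =
    no-return (rotate w i) (rotate-minimal w m i) d 0<d
      (subst (d <_) (sym (length-rotate w i)) (ℕ.m+n≤o⇒n≤o i (subst (_≤ length w) (sym (ℕ.+-suc i d)) i+d<n)))
      (trans (vertex-rotate w i d (ℕ.<⇒≤ i+d<n)) (sym repeated))

  chord-free : ∀ {a} (w : Walk a a) → MinimalOdd w →
               ∀ i d → 0 < d → i + d < length w → H (vertex w i) (vertex w (i + d)) →
               d ≡ 1 ⊎ (i ≡ 0 × suc d ≡ length w)
  chord-free w m i (suc zero) _ _ _ = inj₁ refl
  chord-free w m i d@(suc (suc _)) _ i+d<n h with d + 2 ≤? length w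
  ... | yes d+2≤n = ⊥-elim (no-chord (rotate w i) (rotate-minimal w m i) d (s≤s (s≤s z≤n))
                      (subst (d + 2 ≤_) (sym (length-rotate w i)) d+2≤n)
                      (subst (H (vertex w i)) (sym (vertex-rotate w i d (ℕ.<⇒≤ i+d<n))) h))
  ... | no d+2≰n = inj₂ (wraps-around i d (length w) i+d<n (ℕ.≰⇒> d+2≰n))
    where
    wraps-around : ∀ i d n → i + d < n → n < d + 2 → i ≡ 0 × suc d ≡ n
    wraps-around zero    d n d<n n<d+2 =
      refl , ℕ.≤-antisym d<n (ℕ.≤-pred (subst (n <_) (ℕ.+-comm d 2) n<d+2))
    wraps-around (suc i) d n i+d<n n<d+2 = ⊥-elim (ℕ.<-irrefl refl (ℕ.<-≤-trans n<d+2
      (subst (_≤ n) (ℕ.+-comm 2 d) (ℕ.≤-trans (ℕ.+-monoˡ-≤ d (s≤s (s≤s (z≤n {i})))) i+d<n))))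

  induced-cycle : ∀ {a} (w : Walk a a) → MinimalOdd w → IsInducedCycle H (length w) (λ i → vertex w (toℕ i))
  induced-cycle {a} w m = injective , λ i j → edge⇒consecutive i j , consecutive⇒edge i j
    where
    L : ℕ
    L = length w
    c : Fin L → V
    c i = vertex w (toℕ i)

    gap : ∀ {i j} → i < j → Σ ℕ λ k → i + suc k ≡ j
    gap {i} {j} i<j = j ∸ suc i , trans (ℕ.+-suc i _) (ℕ.m+[n∸m]≡n i<j)

    unequal : ∀ {i j} → toℕ i < toℕ j → ¬ c i ≡ c j
    unequal {i} {j} i<j ci≡cj with gap i<j
    ... | k , i+k≡j = distinct w m (toℕ i) (suc k) (s≤s z≤n)
            (subst (_< L) (sym i+k≡j) (toℕ<n j)) (trans ci≡cj (cong (vertex w) (sym i+k≡j)))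

    injective : ∀ {i j} → c i ≡ c j → i ≡ j
    injective {i} {j} ci≡cj with <-cmp i j
    ... | tri< i<j _ _ = ⊥-elim (unequal i<j ci≡cj)
    ... | tri≈ _ i≡j _ = i≡j
    ... | tri> _ _ j<i = ⊥-elim (unequal j<i (sym ci≡cj))

    forward : ∀ {i j} → toℕ i < toℕ j → H (c i) (c j) → CycAdj L i j
    forward {i} {j} i<j h with gap i<j
    ... | k , i+k≡j with chord-free w m (toℕ i) (suc k) (s≤s z≤n) (subst (_< L) (sym i+k≡j) (toℕ<n j))
                           (subst (λ p → H (c i) (vertex w p)) (sym i+k≡j) h)
    ... | inj₁ refl = inj₁ (inj₁ (trans (ℕ.+-comm 1 (toℕ i)) i+k≡j))
    ... | inj₂ (i≡0 , k+2≡L) =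
          inj₂ (inj₂ (trans (cong suc (trans (sym i+k≡j) (cong (_+ suc k) i≡0))) k+2≡L , i≡0))

    edge⇒consecutive : ∀ i j → H (c i) (c j) → CycAdj L i j
    edge⇒consecutive i j h with <-cmp i j
    ... | tri< i<j _ _ = forward i<j h
    ... | tri≈ _ refl _ = ⊥-elim (H-irrefl h)
    ... | tri> _ _ j<i = swap (forward j<i (H-sym h))

    successor-edge : ∀ i j → Succ L i j → H (c i) (c j)
    successor-edge i j (inj₁ i+1≡j) = subst (λ p → H (c i) (vertex w p)) i+1≡j
      (step w (toℕ i) (subst (_≤ L) (sym i+1≡j) (ℕ.<⇒≤ (toℕ<n j))))
    successor-edge i j (inj₂ (i+1≡L , j≡0)) = subst (H (c i)) closes (step w (toℕ i) (ℕ.≤-reflexive i+1≡L))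
      where
      closes : vertex w (suc (toℕ i)) ≡ c j
      closes = trans (cong (vertex w) i+1≡L) (trans (vertex-end w) (cong (vertex w) (sym j≡0)))

    consecutive⇒edge : ∀ i j → CycAdj L i j → H (c i) (c j)
    consecutive⇒edge i j (inj₁ i→j) = successor-edge i j i→j
    consecutive⇒edge i j (inj₂ j→i) = H-sym (successor-edge j i j→i)

  -- a closed walk all of whose shorter closed walks are even is even:
  -- short ones by the hypotheses, long odd ones would be induced cycles
  even-closed : ∀ {a b} (w : Walk a b) → a ≡ b → EvenBelow (length w) → parity w ≡ false
  even-closed []                        refl _ = refl
  even-closed (h ∷ [])                  refl _ = ⊥-elim (H-irrefl h)
  even-closed (_∷_ {a} {b} h₁ (h₂ ∷ [])) refl _ =
    trans (cong (σ a b xor_) (trans (xor-identityʳ (σ b a)) (sym (σ-sym h₁)))) (xor-same (σ a b))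
  even-closed (_∷_ {a} {b} h₁ (_∷_ {_} {c} h₂ (h₃ ∷ []))) refl _ =
    trans (cong (λ s → σ a b xor (σ b c xor s)) (xor-identityʳ (σ c a))) (σ-triangle h₁ h₂ h₃)
  even-closed w@(_ ∷ _ ∷ _ ∷ _ ∷ _) refl shorter with parity w in odd
  ... | false = refl
  ... | true  = ⊥-elim (chordal (length w) (s≤s (s≤s (s≤s (s≤s z≤n)))) _ (induced-cycle w (odd , shorter)))

  even-below : ∀ L → EvenBelow L
  even-below zero    w a≡b ()
  even-below (suc L) w a≡b (s≤s ℓ≤L) with ℕ.m≤n⇒m<n∨m≡n ℓ≤L
  ... | inj₁ ℓ<L = even-below L w a≡b ℓ<L
  ... | inj₂ refl = even-closed w a≡b (even-below (length w))

  closed-even : ∀ {a b} (w : Walk a b) → a ≡ b → parity w ≡ false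
  closed-even w a≡b = even-below (suc (length w)) w a≡b ℕ.≤-refl

-- A statement about every element of a listed type holds up to double
-- negation once it does for each element; used to decide finitely many
-- reachability questions classically.
¬¬-∀-listed : ∀ {A : Set} {P : A → Set} (xs : List A) → (∀ x → x ∈ xs) →
              (∀ x → ¬ ¬ P x) → ¬ ¬ (∀ x → P x)
¬¬-∀-listed {P = P} xs complete ¬¬P ¬all = on-list xs (λ all-xs → ¬all (λ x → all-xs (complete x)))
  where
  on-list : ∀ ys → ¬ ¬ (∀ {x} → x ∈ ys → P x)
  on-list []       k = k (λ ())
  on-list (y ∷ ys) k = ¬¬P y λ py → on-list ys λ pys → k λ { (here refl) → py ; (there x∈ys) → pys x∈ys }

module Potential {V : Set} (H : V → V → Set) (σ : V → V → Bool)
  (H-sym       : ∀ {a b} → H a b → H b a)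
  (σ-sym       : ∀ {a b} → H a b → σ a b ≡ σ b a)
  (closed-even : ∀ {a b} (w : Walks.Walk H σ a b) → a ≡ b → Walks.parity H σ w ≡ false)
  (vs : List V) (complete : ∀ v → v ∈ vs) where

  open Walks H σ

  reverse : ∀ {a b} → Walk a b → Walk b a
  reverse []      = []
  reverse (h ∷ w) = reverse w ++ (H-sym h ∷ [])

  parity-reverse : ∀ {a b} (w : Walk a b) → parity (reverse w) ≡ parity w
  parity-reverse [] = refl
  parity-reverse (_∷_ {a} {b} h w) = begin
    parity (reverse w ++ (H-sym h ∷ []))     ≡⟨ parity-++ (reverse w) _ ⟩
    parity (reverse w) xor (σ b a xor false) ≡⟨ cong₂ _xor_ (parity-reverse w) (xor-identityʳ (σ b a)) ⟩
    parity w xor σ b a                       ≡⟨ xor-comm (parity w) (σ b a) ⟩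
    σ b a xor parity w                       ≡⟨ cong (_xor parity w) (sym (σ-sym h)) ⟩
    σ a b xor parity w                       ∎
    where open ≡-Reasoning

  parity-unique : ∀ {a b} (p q : Walk a b) → parity p ≡ parity q
  parity-unique p q = xor≡false⇒≡ (parity p) (parity q) (begin
    parity p xor parity q                   ≡⟨ cong (parity p xor_) (sym (parity-reverse q)) ⟩
    parity p xor parity (reverse q)         ≡⟨ sym (parity-++ p (reverse q)) ⟩
    parity (p ++ reverse q)                 ≡⟨ closed-even (p ++ reverse q) refl ⟩
    false                                   ∎)
    where open ≡-Reasoning

  OddWalk : V → V → Set
  OddWalk u v = Σ (Walk u v) λ p → parity p ≡ true

  Decisions : Set
  Decisions = ∀ u v → Dec (Walk u v) × Dec (OddWalk u v)

  decisions : ¬ ¬ Decisions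
  decisions = ¬¬-∀-listed vs complete λ u → ¬¬-∀-listed vs complete λ v k →
    ¬¬-excluded-middle λ walk? → ¬¬-excluded-middle λ odd? → k (walk? , odd?)

  -- given the decisions, label every vertex by the parity of walks to it from the
  -- first listed vertex of its connected component
  module Labelling (D : Decisions) where

    joined? : ∀ v u → Dec (Walk u v)
    joined? v u = proj₁ (D u v)

    roots : V → List V
    roots v = filter (joined? v) vs

    roots-cong : ∀ {v w} → H v w → roots v ≡ roots w
    roots-cong h = filter-≐ (joined? _) (joined? _) ((λ p → p ++ (h ∷ [])) , (λ p → p ++ (H-sym h ∷ []))) vs

    labelFrom : List V → V → Bool
    labelFrom []      v = false
    labelFrom (u ∷ _) v = does (proj₂ (D u v))

    label : V → Bool
    label v = labelFrom (roots v) v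

    decided-parity : ∀ {u v} (p : Walk u v) → does (proj₂ (D u v)) ≡ parity p
    decided-parity {u} {v} p with proj₂ (D u v)
    ... | yes (q , odd) = sym (trans (parity-unique p q) odd)
    ... | no ¬odd with parity p in even
    ...   | true  = ⊥-elim (¬odd (p , even))
    ...   | false = refl

    -- along an edge vw, the walk to w extends the walk to v by one step
    labels-along-edge : ∀ {v w} rs → (∀ {u} → u ∈ rs → Walk u v) → v ∈ rs → H v w →
                        labelFrom rs v xor labelFrom rs w ≡ σ v w
    labels-along-edge {v} {w} (u ∷ _) walk-from _ h = begin
      does (proj₂ (D u v)) xor does (proj₂ (D u w))  ≡⟨ cong₂ _xor_ (decided-parity p) (decided-parity (p ++ (h ∷ []))) ⟩
      parity p xor parity (p ++ (h ∷ []))            ≡⟨ cong (parity p xor_) (parity-++ p (h ∷ [])) ⟩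
      parity p xor (parity p xor (σ v w xor false))  ≡⟨ xor-cancelˡ (parity p) _ ⟩
      σ v w xor false                                ≡⟨ xor-identityʳ (σ v w) ⟩
      σ v w                                          ∎
      where
      open ≡-Reasoning
      p : Walk u v
      p = walk-from (here refl)

    consistent : ∀ {v w} → H v w → label v xor label w ≡ σ v w
    consistent {v} {w} h = subst (λ rs → labelFrom (roots v) v xor labelFrom rs w ≡ σ v w) (roots-cong h)
      (labels-along-edge (roots v) (λ u∈rs → proj₂ (∈-filter⁻ (joined? v) {xs = vs} u∈rs))
        (∈-filter⁺ (joined? v) (complete v) []) h)

  potential : ¬ ¬ Σ (V → Bool) λ ℓ → ∀ {v w} → H v w → ℓ v xor ℓ w ≡ σ v w
  potential k = decisions λ D → k (Labelling.label D , Labelling.consistent D)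

∈-mapMaybe⁺ : ∀ {A B : Set} (f : A → Maybe B) {x y} xs → x ∈ xs → f x ≡ just y → y ∈ mapMaybe f xs
∈-mapMaybe⁺ f (x ∷ xs)  (here refl)  fx≡y rewrite fx≡y = here refl
∈-mapMaybe⁺ f (x′ ∷ xs) (there x∈xs) fx≡y with f x′
... | just _  = there (∈-mapMaybe⁺ f xs x∈xs fx≡y)
... | nothing = ∈-mapMaybe⁺ f xs x∈xs fx≡y

module LineGraph {n : ℕ} (G : Graph n) where

  e₁ e₂ : Edge G → Fin n
  e₁ = end₁ G
  e₂ = end₂ G

  IsEnd : Edge G → Fin n → Set
  IsEnd e x = x ≡ e₁ e ⊎ x ≡ e₂ e

  SameEnds : Edge G → Edge G → Set
  SameEnds e f = e₁ e ≡ e₁ f × e₂ e ≡ e₂ f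

  e₁<e₂ : ∀ e → toℕ (e₁ e) < toℕ (e₂ e)
  e₁<e₂ (_ , _ , i<j , _) = i<j

  adjacent-ends : ∀ e → Adj G (e₁ e) (e₂ e)
  adjacent-ends (_ , _ , _ , a) = a

  two-ends : ∀ e {x y} → ¬ x ≡ y → IsEnd e x → IsEnd e y →
             (x ≡ e₁ e × y ≡ e₂ e) ⊎ (x ≡ e₂ e × y ≡ e₁ e)
  two-ends e x≢y (inj₁ x≡) (inj₁ y≡) = ⊥-elim (x≢y (trans x≡ (sym y≡)))
  two-ends e x≢y (inj₁ x≡) (inj₂ y≡) = inj₁ (x≡ , y≡)
  two-ends e x≢y (inj₂ x≡) (inj₁ y≡) = inj₂ (x≡ , y≡)
  two-ends e x≢y (inj₂ x≡) (inj₂ y≡) = ⊥-elim (x≢y (trans x≡ (sym y≡)))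

  ends-adjacent : ∀ e {x y} → IsEnd e x → IsEnd e y → ¬ x ≡ y → Adj G x y
  ends-adjacent e ex ey x≢y with two-ends e x≢y ex ey
  ... | inj₁ (refl , refl) = adjacent-ends e
  ... | inj₂ (refl , refl) = Graph.sym G _ _ (adjacent-ends e)

  common-unique : ∀ {e f x y} → ¬ SameEnds e f →
                  IsEnd e x → IsEnd f x → IsEnd e y → IsEnd f y → x ≡ y
  common-unique {e} {f} {x} {y} e≠f ex fx ey fy with x ≟ y
  ... | yes x≡y = x≡y
  ... | no x≢y with two-ends e x≢y ex ey | two-ends f x≢y fx fy
  ... | inj₁ (x≡e₁ , y≡e₂) | inj₁ (x≡f₁ , y≡f₂) = ⊥-elim (e≠f (trans (sym x≡e₁) x≡f₁ , trans (sym y≡e₂) y≡f₂))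
  ... | inj₂ (x≡e₂ , y≡e₁) | inj₂ (x≡f₂ , y≡f₁) = ⊥-elim (e≠f (trans (sym y≡e₁) y≡f₁ , trans (sym x≡e₂) x≡f₂))
  ... | inj₁ (refl , refl) | inj₂ (x≡f₂ , y≡f₁) =
        ⊥-elim (ℕ.<-asym (e₁<e₂ e) (subst₂ (λ u v → toℕ u < toℕ v) (sym y≡f₁) (sym x≡f₂) (e₁<e₂ f)))
  ... | inj₂ (refl , refl) | inj₁ (x≡f₁ , y≡f₂) =
        ⊥-elim (ℕ.<-asym (e₁<e₂ e) (subst₂ (λ u v → toℕ u < toℕ v) (sym x≡f₁) (sym y≡f₂) (e₁<e₂ f)))

  third-end : ∀ e {x y z} → IsEnd e x → IsEnd e y → IsEnd e z → ¬ x ≡ y → ¬ x ≡ z → y ≡ z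
  third-end e ex ey ez x≢y x≢z with two-ends e x≢y ex ey | two-ends e x≢z ex ez
  ... | inj₁ (_ , y≡e₂) | inj₁ (_ , z≡e₂) = trans y≡e₂ (sym z≡e₂)
  ... | inj₂ (_ , y≡e₁) | inj₂ (_ , z≡e₁) = trans y≡e₁ (sym z≡e₁)
  ... | inj₁ (x≡e₁ , _) | inj₂ (x≡e₂ , _) = ⊥-elim (ℕ.<-irrefl (cong toℕ (trans (sym x≡e₁) x≡e₂)) (e₁<e₂ e))
  ... | inj₂ (x≡e₂ , _) | inj₁ (x≡e₁ , _) = ⊥-elim (ℕ.<-irrefl (cong toℕ (trans (sym x≡e₁) x≡e₂)) (e₁<e₂ e))

  meet : Edge G → Edge G → Fin n
  meet e f with e₁ e ≟ e₁ f | e₁ e ≟ e₂ f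
  ... | yes _ | _     = e₁ e
  ... | no _  | yes _ = e₁ e
  ... | no _  | no _  = e₂ e

  meet-common : ∀ e f → LineAdj G e f → IsEnd e (meet e f) × IsEnd f (meet e f)
  meet-common e f e~f with e₁ e ≟ e₁ f | e₁ e ≟ e₂ f
  ... | yes e₁≡f₁ | _         = inj₁ refl , inj₁ e₁≡f₁
  ... | no _      | yes e₁≡f₂ = inj₁ refl , inj₂ e₁≡f₂
  ... | no e₁≢f₁  | no e₁≢f₂ with proj₂ e~f
  ...   | inj₁ e₁≡f₁                = ⊥-elim (e₁≢f₁ e₁≡f₁)
  ...   | inj₂ (inj₁ e₁≡f₂)         = ⊥-elim (e₁≢f₂ e₁≡f₂)
  ...   | inj₂ (inj₂ (inj₁ e₂≡f₁))  = inj₂ refl , inj₁ e₂≡f₁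
  ...   | inj₂ (inj₂ (inj₂ e₂≡f₂))  = inj₂ refl , inj₂ e₂≡f₂

  firstEnd : Edge G → Fin n → Bool
  firstEnd e x = does (x ≟ e₁ e)

  sign : Edge G → Edge G → Bool
  sign e f = firstEnd e (meet e f) xor firstEnd f (meet e f)

  sign-at : ∀ {e f x} → LineAdj G e f → IsEnd e x → IsEnd f x → sign e f ≡ firstEnd e x xor firstEnd f x
  sign-at {e} {f} e~f ex fx = cong (λ m → firstEnd e m xor firstEnd f m)
    (common-unique {e} {f} (proj₁ e~f) (proj₁ (meet-common e f e~f)) (proj₂ (meet-common e f e~f)) ex fx)

  sign-sym : ∀ {e f} → LineAdj G e f → LineAdj G f e → sign e f ≡ sign f e
  sign-sym {e} {f} e~f f~e = trans (xor-comm (firstEnd e m) (firstEnd f m))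
    (sym (sign-at {f} {e} f~e (proj₂ (meet-common e f e~f)) (proj₁ (meet-common e f e~f))))
    where
    m : Fin n
    m = meet e f

  -- three edges meeting pairwise in x, y, z have a common end unless xyz is a triangle
  common-end : TriangleFree G → ∀ {e f g x y z} →
               IsEnd e x → IsEnd f x → IsEnd f y → IsEnd g y → IsEnd g z → IsEnd e z →
               Σ (Fin n) λ v → IsEnd e v × IsEnd f v × IsEnd g v
  common-end triangle-free {e} {f} {g} {x} {y} {z} ex fx fy gy gz ez with x ≟ y | y ≟ z | z ≟ x
  ... | yes refl | _        | _        = x , ex , fx , gy
  ... | no _     | yes refl | _        = y , ez , fy , gy
  ... | no _     | no _     | yes refl = z , ez , fx , gz
  ... | no x≢y   | no y≢z   | no z≢x   = ⊥-elim (triangle-free x y z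
        (ends-adjacent f fx fy x≢y , ends-adjacent g gy gz y≢z , ends-adjacent e ex ez (λ x≡z → z≢x (sym x≡z))))

  star : TriangleFree G → ∀ {e f g} → LineAdj G e f → LineAdj G f g → LineAdj G g e →
         Σ (Fin n) λ v → IsEnd e v × IsEnd f v × IsEnd g v
  star triangle-free {e} {f} {g} e~f f~g g~e = common-end triangle-free {e} {f} {g}
    (proj₁ (meet-common e f e~f)) (proj₂ (meet-common e f e~f))
    (proj₁ (meet-common f g f~g)) (proj₂ (meet-common f g f~g))
    (proj₁ (meet-common g e g~e)) (proj₂ (meet-common g e g~e))

  sign-triangle : TriangleFree G → ∀ {e f g} → LineAdj G e f → LineAdj G f g → LineAdj G g e →
                  sign e f xor (sign f g xor sign g e) ≡ false
  sign-triangle triangle-free {e} {f} {g} e~f f~g g~e with star triangle-free {e} {f} {g} e~f f~g g~e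
  ... | v , ev , fv , gv = begin
    sign e f xor (sign f g xor sign g e)
      ≡⟨ cong₂ (λ s t → s xor (t xor sign g e)) (sign-at {e} {f} e~f ev fv) (sign-at {f} {g} f~g fv gv) ⟩
    (firstEnd e v xor firstEnd f v) xor ((firstEnd f v xor firstEnd g v) xor sign g e)
      ≡⟨ cong (λ s → (firstEnd e v xor firstEnd f v) xor ((firstEnd f v xor firstEnd g v) xor s)) (sign-at {g} {e} g~e gv ev) ⟩
    (firstEnd e v xor firstEnd f v) xor ((firstEnd f v xor firstEnd g v) xor (firstEnd g v xor firstEnd e v))
      ≡⟨ xor-cycle (firstEnd e v) (firstEnd f v) (firstEnd g v) ⟩
    false ∎
    where open ≡-Reasoning

  adjacent⇒distinct : ∀ {x y} → Adj G x y → ¬ x ≡ y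
  adjacent⇒distinct {x} a refl = irrefl G x a

  edgeOf : ∀ x y → Adj G x y → Edge G
  edgeOf x y a with <-cmp x y
  ... | tri< x<y _ _ = x , y , x<y , a
  ... | tri≈ _ x≡y _ = ⊥-elim (adjacent⇒distinct a x≡y)
  ... | tri> _ _ y<x = y , x , y<x , Graph.sym G x y a

  edgeOf-ends : ∀ x y (a : Adj G x y) → IsEnd (edgeOf x y a) x × IsEnd (edgeOf x y a) y
  edgeOf-ends x y a with <-cmp x y
  ... | tri< _ _ _   = inj₁ refl , inj₂ refl
  ... | tri≈ _ x≡y _ = ⊥-elim (adjacent⇒distinct a x≡y)
  ... | tri> _ _ _   = inj₂ refl , inj₁ refl

  touching : ∀ {e f x} → IsEnd e x → IsEnd f x →
             e₁ e ≡ e₁ f ⊎ e₁ e ≡ e₂ f ⊎ e₂ e ≡ e₁ f ⊎ e₂ e ≡ e₂ f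
  touching (inj₁ x≡e₁) (inj₁ x≡f₁) = inj₁ (trans (sym x≡e₁) x≡f₁)
  touching (inj₁ x≡e₁) (inj₂ x≡f₂) = inj₂ (inj₁ (trans (sym x≡e₁) x≡f₂))
  touching (inj₂ x≡e₂) (inj₁ x≡f₁) = inj₂ (inj₂ (inj₁ (trans (sym x≡e₂) x≡f₁)))
  touching (inj₂ x≡e₂) (inj₂ x≡f₂) = inj₂ (inj₂ (inj₂ (trans (sym x≡e₂) x≡f₂)))

  edgeOf-lineAdj : ∀ {x y z} (a : Adj G x y) (b : Adj G x z) → ¬ y ≡ z →
                   LineAdj G (edgeOf x y a) (edgeOf x z b)
  edgeOf-lineAdj {x} {y} {z} a b y≢z = different , touching {e} {f} ex fx
    where
    e f : Edge G
    e = edgeOf x y a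
    f = edgeOf x z b
    ex : IsEnd e x
    ex = proj₁ (edgeOf-ends x y a)
    fx : IsEnd f x
    fx = proj₁ (edgeOf-ends x z b)
    different : ¬ SameEnds e f
    different (e₁≡f₁ , e₂≡f₂) with proj₂ (edgeOf-ends x z b)
    ... | inj₁ z≡f₁ = y≢z (third-end e ex (proj₂ (edgeOf-ends x y a)) (inj₁ (trans z≡f₁ (sym e₁≡f₁)))
                        (adjacent⇒distinct a) (adjacent⇒distinct b))
    ... | inj₂ z≡f₂ = y≢z (third-end e ex (proj₂ (edgeOf-ends x y a)) (inj₂ (trans z≡f₂ (sym e₂≡f₂)))
                        (adjacent⇒distinct a) (adjacent⇒distinct b))

  toEdge : Fin n → Fin n → Maybe (Edge G)
  toEdge i j with i <? j | adj G i j ≟ᵇ true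
  ... | yes i<j | yes a = just (i , j , i<j , a)
  ... | _       | _     = nothing

  toEdge-ends : ∀ e → toEdge (e₁ e) (e₂ e) ≡ just e
  toEdge-ends (i , j , i<j , a) with i <? j | adj G i j ≟ᵇ true
  ... | yes i<j′ | yes a′ = cong just (cong₂ (λ p q → i , j , p , q) (<-irrelevant i<j′ i<j) (Bool-UIP a′ a))
    where open Decidable⇒UIP _≟ᵇ_ renaming (≡-irrelevant to Bool-UIP)
  ... | no i≮j   | _      = ⊥-elim (i≮j i<j)
  ... | yes _    | no ¬a  = ⊥-elim (¬a a)

  allEdges : List (Edge G)
  allEdges = mapMaybe (uncurry toEdge) (cartesianProduct (allFin n) (allFin n))

  allEdges-complete : ∀ e → e ∈ allEdges
  allEdges-complete e = ∈-mapMaybe⁺ (uncurry toEdge) _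
    (∈-cartesianProduct⁺ (∈-allFin (e₁ e)) (∈-allFin (e₂ e))) (toEdge-ends e)

module Orientations {n : ℕ} (G : Graph n) where

  open LineGraph G

  -- a direction rule: towards v u tells whether the edge uv points towards v
  Antisymmetric : (Fin n → Fin n → Bool) → Set
  Antisymmetric towards = ∀ u v → ¬ u ≡ v → towards u v ≡ not (towards v u)

  orientation : (towards : Fin n → Fin n → Bool) → Antisymmetric towards → Orientation G
  orientation towards anti = record { arc = arc ; total = total ; arcEdge = λ _ _ → proj₁ ; antisym = antisym }
    where
    arc : Fin n → Fin n → Set
    arc u v = Adj G u v × towards v u ≡ true
    total : ∀ u v → Adj G u v → arc u v ⊎ arc v u
    total u v a = by-direction (towards v u) refl
      where
      by-direction : ∀ b → towards v u ≡ b → arc u v ⊎ arc v u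
      by-direction true  toward-v = inj₁ (a , toward-v)
      by-direction false away-v   = inj₂ (Graph.sym G u v a , trans (anti u v (adjacent⇒distinct a)) (cong not away-v))
    antisym : ∀ u v → arc u v → ¬ arc v u
    antisym u v (a , toward-v) (_ , toward-u) =
      true≢false (trans (sym toward-u) (trans (anti u v (adjacent⇒distinct a)) (cong not toward-v)))

  elbow : ∀ towards anti {x y z} → Adj G x y → Adj G x z → towards x y ≡ towards x z →
          Elbow (orientation towards anti) x y z
  elbow towards anti {x} {y} {z} a b same = by-direction (towards x y) refl
    where
    y≢x : ¬ y ≡ x
    y≢x y≡x = adjacent⇒distinct a (sym y≡x)
    z≢x : ¬ z ≡ x
    z≢x z≡x = adjacent⇒distinct b (sym z≡x)
    by-direction : ∀ d → towards x y ≡ d → Elbow (orientation towards anti) x y z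
    by-direction true  toward-x =
      inj₁ ((Graph.sym G x y a , toward-x) , (Graph.sym G x z b , trans (sym same) toward-x))
    by-direction false away-x =
      inj₂ ((a , trans (anti y x y≢x) (cong not away-x)) , (b , trans (anti z x z≢x) (cong not (trans (sym same) away-x))))

  -- the direction rule of a code, where code i j (for i < j) tells whether
  -- the edge ij points from i to j
  towardsOf : (Fin n → Fin n → Bool) → Fin n → Fin n → Bool
  towardsOf code v u with <-cmp u v
  ... | tri< _ _ _ = code u v
  ... | tri≈ _ _ _ = false
  ... | tri> _ _ _ = not (code v u)

  towardsOf-< : ∀ code {u v} → u F.< v → towardsOf code v u ≡ code u v
  towardsOf-< code {u} {v} u<v with <-cmp u v
  ... | tri< _ _ _    = refl
  ... | tri≈ u≮v _ _  = ⊥-elim (u≮v u<v)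
  ... | tri> u≮v _ _  = ⊥-elim (u≮v u<v)

  towardsOf-> : ∀ code {u v} → v F.< u → towardsOf code v u ≡ not (code v u)
  towardsOf-> code {u} {v} v<u with <-cmp u v
  ... | tri< _ _ v≮u  = ⊥-elim (v≮u v<u)
  ... | tri≈ _ _ v≮u  = ⊥-elim (v≮u v<u)
  ... | tri> _ _ _    = refl

  towardsOf-antisym : ∀ code → Antisymmetric (towardsOf code)
  towardsOf-antisym code u v u≢v with <-cmp v u
  ... | tri< v<u _ _ = sym (trans (cong not (towardsOf-> code v<u)) (not-involutive (code v u)))
  ... | tri≈ _ v≡u _ = ⊥-elim (u≢v (sym v≡u))
  ... | tri> _ _ u<v = cong not (sym (towardsOf-< code u<v))

  towards-edge : ∀ code (ℓ : Edge G → Bool) e → code (e₁ e) (e₂ e) ≡ ℓ e →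
                 ∀ {x y} → ¬ x ≡ y → IsEnd e x → IsEnd e y → towardsOf code x y ≡ firstEnd e x xor ℓ e
  towards-edge code ℓ e code≡ℓ x≢y ex ey with two-ends e x≢y ex ey
  ... | inj₁ (refl , refl) = begin
    towardsOf code (e₁ e) (e₂ e)     ≡⟨ towardsOf-> code (e₁<e₂ e) ⟩
    not (code (e₁ e) (e₂ e))         ≡⟨ cong not code≡ℓ ⟩
    true xor ℓ e                     ≡⟨ cong (_xor ℓ e) (sym (dec-true (e₁ e ≟ e₁ e) refl)) ⟩
    firstEnd e (e₁ e) xor ℓ e        ∎
    where open ≡-Reasoning
  ... | inj₂ (refl , refl) = begin
    towardsOf code (e₂ e) (e₁ e)     ≡⟨ towardsOf-< code (e₁<e₂ e) ⟩
    code (e₁ e) (e₂ e)               ≡⟨ code≡ℓ ⟩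
    false xor ℓ e                    ≡⟨ cong (_xor ℓ e) (sym (dec-false (e₂ e ≟ e₁ e) (λ e₂≡e₁ → x≢y e₂≡e₁))) ⟩
    firstEnd e (e₂ e) xor ℓ e        ∎
    where open ≡-Reasoning

module ChordalCoverToElbowCover {n : ℕ} (G : Graph n) (triangle-free : TriangleFree G)
                                {k : ℕ} (cover : ChordalCover (LineAdj G) k) where

  open LineGraph G
  open Orientations G
  open ChordalCover cover

  assign : Fin n → Fin n → Fin n → Maybe (Fin k)
  assign x y z with adj G x y ≟ᵇ true | adj G x z ≟ᵇ true | y ≟ z
  ... | yes a | yes b | no y≢z = just (proj₁ (coverE (edgeOf x y a) (edgeOf x z b) (edgeOf-lineAdj {x} {y} {z} a b y≢z)))
  ... | _     | _     | _      = nothing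

  assign-defined : ∀ {x y z} → Adj G x y → Adj G x z → ¬ y ≡ z → Σ (Fin k) λ t → assign x y z ≡ just t
  assign-defined {x} {y} {z} a b y≢z with adj G x y ≟ᵇ true | adj G x z ≟ᵇ true | y ≟ z
  ... | yes _ | yes _ | no _     = _ , refl
  ... | yes _ | yes _ | yes y≡z  = ⊥-elim (y≢z y≡z)
  ... | yes _ | no ¬b | _        = ⊥-elim (¬b b)
  ... | no ¬a | _     | _        = ⊥-elim (¬a a)

  assign-sound : ∀ {x y z t} → assign x y z ≡ just t →
                 Σ (Adj G x y) λ a → Σ (Adj G x z) λ b → ChordalSubgraph.edges (part t) (edgeOf x y a) (edgeOf x z b)
  assign-sound {x} {y} {z} with adj G x y ≟ᵇ true | adj G x z ≟ᵇ true | y ≟ z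
  ... | yes a | yes b | no y≢z = λ { refl → a , b , proj₂ (coverE (edgeOf x y a) (edgeOf x z b) (edgeOf-lineAdj {x} {y} {z} a b y≢z)) }
  ... | yes _ | yes _ | yes _  = λ ()
  ... | yes _ | no _  | _      = λ ()
  ... | no _  | _     | _      = λ ()

  -- each part is a chordal subgraph of L(G) whose triangles are stars, so its
  -- edges admit a labelling whose differences are the signs, up to double negation
  module Part (t : Fin k) where
    open ChordalSubgraph (part t)

    edges-sym : ∀ {e f} → edges e f → edges f e
    edges-sym = esym _ _

    edges-irrefl : ∀ {e} → ¬ edges e e
    edges-irrefl h = proj₁ (sub _ _ h) (refl , refl)

    edges-sign-sym : ∀ {e f} → edges e f → sign e f ≡ sign f e
    edges-sign-sym {e} {f} h = sign-sym {e} {f} (sub _ _ h) (sub _ _ (edges-sym h))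

    edges-sign-triangle : ∀ {e f g} → edges e f → edges f g → edges g e → sign e f xor (sign f g xor sign g e) ≡ false
    edges-sign-triangle h₁ h₂ h₃ = sign-triangle triangle-free (sub _ _ h₁) (sub _ _ h₂) (sub _ _ h₃)

    open Balance edges sign edges-sym edges-irrefl edges-sign-sym edges-sign-triangle chordal using (closed-even)
    open Potential edges sign edges-sym edges-sign-sym closed-even allEdges allEdges-complete using (potential) public

  -- orientations are searched among codes: a bit for every ordered pair of vertices
  Code : Set
  Code = Subset (n * n)

  bit : Code → Fin n → Fin n → Bool
  bit S i j = Vec.lookup S (F.combine i j)

  codeOf : (Fin n → Fin n → Bool) → Code
  codeOf code = Vec.tabulate (λ c → uncurry code (F.remQuot n c))

  bit-codeOf : ∀ code i j → bit (codeOf code) i j ≡ code i j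
  bit-codeOf code i j = trans (lookup∘tabulate _ (F.combine i j)) (cong (uncurry code) (remQuot-combine i j))

  Good : Fin k → Code → Set
  Good t S = ∀ x y z → assign x y z ≡ just t → towardsOf (bit S) x y ≡ towardsOf (bit S) x z

  good? : ∀ t S → Dec (Good t S)
  good? t S = all? λ x → all? λ y → all? λ z →
    ≡-dec _≟_ (assign x y z) (just t) →-dec (towardsOf (bit S) x y ≟ᵇ towardsOf (bit S) x z)

  labelCode : (Edge G → Bool) → Fin n → Fin n → Bool
  labelCode ℓ i j = maybe ℓ false (toEdge i j)

  -- a labelling consistent with the signs on the part t is good for t: along the
  -- edge {xy, xz} of the part, both edges point the same way at x
  labelling⇒good : ∀ t (ℓ : Edge G → Bool) →
                   (∀ {e f} → ChordalSubgraph.edges (part t) e f → ℓ e xor ℓ f ≡ sign e f) →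
                   Good t (codeOf (labelCode ℓ))
  labelling⇒good t ℓ consistent x y z assigned with assign-sound assigned
  ... | a , b , h = begin
    towardsOf code x y      ≡⟨ towards-edge code ℓ e (code-edge e) (adjacent⇒distinct a) ex ey ⟩
    firstEnd e x xor ℓ e    ≡⟨ xor-transpose (ℓ e) (ℓ f) (firstEnd e x) (firstEnd f x)
                                 (trans (consistent h) (sign-at {e} {f} (ChordalSubgraph.sub (part t) e f h) ex fx)) ⟩
    firstEnd f x xor ℓ f    ≡⟨ sym (towards-edge code ℓ f (code-edge f) (adjacent⇒distinct b) fx fz) ⟩
    towardsOf code x z      ∎
    where
    open ≡-Reasoning
    code : Fin n → Fin n → Bool
    code = bit (codeOf (labelCode ℓ))
    code-edge : ∀ g → code (e₁ g) (e₂ g) ≡ ℓ g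
    code-edge g = trans (bit-codeOf (labelCode ℓ) (e₁ g) (e₂ g)) (cong (maybe ℓ false) (toEdge-ends g))
    e f : Edge G
    e = edgeOf x y a
    f = edgeOf x z b
    ex : IsEnd e x
    ex = proj₁ (edgeOf-ends x y a)
    ey : IsEnd e y
    ey = proj₂ (edgeOf-ends x y a)
    fx : IsEnd f x
    fx = proj₁ (edgeOf-ends x z b)
    fz : IsEnd f z
    fz = proj₂ (edgeOf-ends x z b)

  -- a good code exists: its absence is decidable and refuted by the labelling
  good-code : ∀ t → Σ Code (Good t)
  good-code t with anySubset? (good? t)
  ... | yes found = found
  ... | no none   = ⊥-elim (Part.potential t λ (ℓ , consistent) →
                      none (codeOf (labelCode ℓ) , labelling⇒good t ℓ consistent))

  elbowCover : ElbowCover G k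
  elbowCover = orient , covers
    where
    chosen : Fin k → Fin n → Fin n → Bool
    chosen t = bit (proj₁ (good-code t))
    orient : Fin k → Orientation G
    orient t = orientation (towardsOf (chosen t)) (towardsOf-antisym (chosen t))
    covers : ∀ x y z → Adj G x y → Adj G x z → ¬ y ≡ z → Σ (Fin k) λ t → Elbow (orient t) x y z
    covers x y z a b y≢z with assign-defined a b y≢z
    ... | t , assigned = t , elbow (towardsOf (chosen t)) (towardsOf-antisym (chosen t)) a b
                               (proj₂ (good-code t) x y z assigned)

theorem4 : ∀ {n} (G : Graph n) → TriangleFree G →
             ∀ k → ChordalCover (LineAdj G) k → ∃[ m ] (m ≤ k × ElbowCover G m)
theorem4 G triangle-free k cover = k , ℕ.≤-refl , ChordalCoverToElbowCover.elbowCover G triangle-free cover
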